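{- Let $D$ be a digraph with $n$ vertices, where $n \equiv 1 \pmod 4$, in which every vertex has odd out-degree. Then either there are $3$ vertices of $D$ such that the subdigraph induced on them has exactly $2$ vertices of odd out-degree, or there are $5$ vertices of $D$ such that the subdigraph induced on them has exactly $3$ vertices of odd out-degree.
   Context: A digraph here has no loops and no multiple arcs with the same direction; for distinct vertices $i,j$, the arcs $(i,j)$ and $(j,i)$ may both be present. Out-degrees in an induced subdigraph count only arcs between vertices of that subset. -}

module Defs where

open import Data.Nat using (ℕ; _%_)
open import Data.Bool using (Bool; true; false)
open import Data.Fin using (Fin)
open import Data.Fin.Subset using (Subset; _∩_; ∣_∣; _∈_)
open import Data.Vec using (tabulate; lookup)
open import Relation.Binary.PropositionalEquality using (_≡_)
open import Relation.Nullary.Decidable using (⌊_⌋)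
open import Data.Nat using (_≟_)
open import Data.Bool using (_∧_)

-- Loops are excluded by the Loopless condition; multiple arcs are impossible
-- by construction; (u,v) and (v,u) may both be arcs.
record Digraph (n : ℕ) : Set where
  field
    adj : Fin n → Fin n → Bool
    loopless : ∀ v → adj v v ≡ false
open Digraph public

outNbhd : ∀ {n} → Digraph n → Fin n → Subset n
outNbhd D v = tabulate (adj D v)

outDeg : ∀ {n} → Digraph n → Fin n → ℕ
outDeg D v = ∣ outNbhd D v ∣

outDegIn : ∀ {n} → Digraph n → Subset n → Fin n → ℕ
outDegIn D S v = ∣ S ∩ outNbhd D v ∣

isOdd : ℕ → Bool
isOdd k = ⌊ k % 2 ≟ 1 ⌋

oddVerticesIn : ∀ {n} → Digraph n → Subset n → Subset n
oddVerticesIn D S = tabulate (λ v → lookup S v ∧ isOdd (outDegIn D S v))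

-- Suppose there is no such 3- or 5-set.  Call a pair of vertices asymmetric if it carries
-- exactly one arc.  By strong induction on |U| we show that no vertex set U with |U| ≡ 1 (mod 4)
-- induces a subdigraph whose out-degrees are all odd; U = V(D) then gives the theorem.
--   Case A: every triangle of U has an odd number of asymmetric pairs.  Then the asymmetric pairs
--   are exactly the pairs inside the two parts of a bipartition of U, and counting the arcs of
--   D[U] modulo 4 contradicts |U| ≡ 1 and all out-degrees being odd.
--   Case B: some triangle x, y, z has an even number.  Then every corner sends the same arc to
--   both other corners.  A corner together with the vertices of U it separates forms a block;
--   the three blocks are disjoint and, by induction, of size ≡ 0 (mod 4), and the vertices of U
--   outside the blocks form a smaller set of size ≡ 1 (mod 4) with all out-degrees odd.
module Submission where

open import Defs
open import Data.Bool using (Bool; true; false; not; _∧_; _∨_; _xor_; T)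
open import Data.Bool.Properties
  using (∧-identityʳ; ∧-zeroʳ; ∧-comm; xor-same; xor-comm; xor-identityʳ; not-involutive)
  renaming (_≟_ to _≟ᵇ_)
open import Data.Empty using (⊥; ⊥-elim)
open import Data.Fin using (Fin; zero; suc)
open import Data.Fin.Patterns using (0F; 1F; 2F; 3F; 4F)
open import Data.Fin.Properties using (_≟_; all?; any?; suc-injective)
open import Data.Fin.Subset using (Subset; ∣_∣; _∩_)
open import Data.Fin.Subset.Properties using (anySubset?)
open import Data.Nat using (ℕ; zero; suc; _+_; _*_; _%_; _/_; _<_; _≤_; _≡ᵇ_; z≤n; s≤s) renaming (_≟_ to _≟ℕ_)
open import Data.Nat.DivMod using (m≡m%n+[m/n]*n)
open import Data.Nat.Induction using (<-rec)
open import Data.Nat.Properties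
  using (≡ᵇ⇒≡; +-*-semiring; +-identityʳ; +-comm; *-identityʳ; *-zeroʳ; ≤-trans; m≤n+m; m<m+n)
open import Data.Nat.Tactic.RingSolver using (solve-∀)
open import Algebra.Properties.Semiring.Sum +-*-semiring
  using (sum; sum-cong-≗; ∑-distrib-+; ∑-comm; *-distribˡ-sum; *-distribʳ-sum; sum-replicate-zero)
open import Data.Product using (Σ; ∃; _×_; _,_; proj₁; proj₂)
open import Data.Sum using (_⊎_; inj₁; inj₂)
open import Data.Unit using (tt)
open import Data.Vec using (tabulate; lookup) renaming (_∷_ to _∷ᵛ_)
open import Data.Vec.Functional using (Vector; []; _∷_; foldr)
open import Data.Vec.Properties using (lookup∘tabulate)
open import Relation.Binary.PropositionalEquality
  using (_≡_; _≢_; refl; sym; trans; cong; cong₂; subst; module ≡-Reasoning)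
open import Relation.Nullary using (Dec; yes; no; does)
open import Relation.Nullary.Decidable using (dec-true; dec-false; from-yes; map′; _×-dec_; _→-dec_; ¬?)

private
  variable
    n k : ℕ

true≢false : true ≢ false
true≢false ()

false≢true : false ≢ true
false≢true ()

xor-true : ∀ {a b} → a xor b ≡ true → a ≡ not b
xor-true {true} {false} _ = refl
xor-true {false} {true} _ = refl

xor-false : ∀ {a b} → a xor b ≡ false → a ≡ b
xor-false {true} {true} _ = refl
xor-false {false} {false} _ = refl

∧-true : ∀ {a b} → a ∧ b ≡ true → (a ≡ true) × (b ≡ true)
∧-true {true} {true} _ = refl , refl

⟦_⟧ : Bool → ℕ
⟦ true ⟧ = 1
⟦ false ⟧ = 0

VSet : ℕ → Set
VSet n = Fin n → Bool

count : VSet n → ℕ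
count V = sum (λ i → ⟦ V i ⟧)

countIn : VSet n → (Fin n → Bool) → ℕ
countIn V g = count (λ i → V i ∧ g i)

_==_ : Fin n → Fin n → Bool
i == j = does (i ≟ j)

⁅_⁆ : Fin n → VSet n
⁅ v ⁆ i = i == v

_∖_ : VSet n → VSet n → VSet n
(V ∖ W) i = V i ∧ not (W i)

_⊆_ : VSet n → VSet n → Set
W ⊆ V = ∀ i → W i ≡ true → V i ≡ true

==-self : (i : Fin n) → (i == i) ≡ true
==-self i = dec-true (i ≟ i) refl

==-other : {i j : Fin n} → i ≢ j → (i == j) ≡ false
==-other {i = i} {j} i≢j = dec-false (i ≟ j) i≢j

∖-member : {V W : VSet n} {i : Fin n} → (V ∖ W) i ≡ true → (V i ≡ true) × (W i ≡ false)
∖-member {V = V} {W} {i} h with V i | W i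
... | true | false = refl , refl

∖-intro : {V W : VSet n} {i : Fin n} → V i ≡ true → W i ≡ false → (V ∖ W) i ≡ true
∖-intro Vi Wi rewrite Vi | Wi = refl

∖-excludes : {V W : VSet n} {i : Fin n} → W i ≡ true → (V ∖ W) i ≡ false
∖-excludes {V = V} {i = i} Wi rewrite Wi = ∧-zeroʳ (V i)

contrapositive : ∀ {a b} → (a ≡ true → b ≡ false) → b ≡ true → a ≡ false
contrapositive {false} implication b≡true = refl
contrapositive {true} implication b≡true = ⊥-elim (true≢false (trans (sym b≡true) (implication refl)))

⊆-false : {V W : VSet n} → W ⊆ V → {i : Fin n} → V i ≡ false → W i ≡ false
⊆-false {W = W} W⊆V {i} Vi with W i in Wi
... | true = ⊥-elim (true≢false (trans (sym (W⊆V i Wi)) Vi))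
... | false = refl

count-as-countIn : (V : VSet n) → count V ≡ countIn V (λ _ → true)
count-as-countIn V = sum-cong-≗ (λ i → cong ⟦_⟧ (sym (∧-identityʳ (V i))))

countIn-⁅⁆ : (v : Fin n) (g : Fin n → Bool) → countIn ⁅ v ⁆ g ≡ ⟦ g v ⟧
countIn-⁅⁆ {suc n} zero g = trans (cong (⟦ g zero ⟧ +_) (sum-replicate-zero n)) (+-identityʳ _)
countIn-⁅⁆ {suc n} (suc v) g = countIn-⁅⁆ v (λ i → g (suc i))

countIn-∖ : {V W : VSet n} → W ⊆ V → (g : Fin n → Bool) →
  countIn V g ≡ countIn W g + countIn (V ∖ W) g
countIn-∖ {V = V} {W} W⊆V g =
  trans (sum-cong-≗ split) (∑-distrib-+ (λ i → ⟦ W i ∧ g i ⟧) (λ i → ⟦ (V ∖ W) i ∧ g i ⟧))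
  where
  split : ∀ i → ⟦ V i ∧ g i ⟧ ≡ ⟦ W i ∧ g i ⟧ + ⟦ (V i ∧ not (W i)) ∧ g i ⟧
  split i with W i in Wi
  ... | true rewrite W⊆V i Wi = sym (+-identityʳ _)
  ... | false with V i
  ...   | true = refl
  ...   | false = refl

count-∖ : {V W : VSet n} → W ⊆ V → count V ≡ count W + count (V ∖ W)
count-∖ {V = V} {W} W⊆V = begin
  count V                                               ≡⟨ count-as-countIn V ⟩
  countIn V (λ _ → true)                                ≡⟨ countIn-∖ W⊆V _ ⟩
  countIn W (λ _ → true) + countIn (V ∖ W) (λ _ → true) ≡⟨ sym (cong₂ _+_ (count-as-countIn W) (count-as-countIn (V ∖ W))) ⟩
  count W + count (V ∖ W)                               ∎
  where open ≡-Reasoning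

countIn-const : {V : VSet n} {g : Fin n → Bool} (b : Bool) → (∀ i → V i ≡ true → g i ≡ b) →
  countIn V g ≡ ⟦ b ⟧ * count V
countIn-const {V = V} {g} b const = trans (sum-cong-≗ pointwise) (sym (*-distribˡ-sum ⟦ b ⟧ (λ i → ⟦ V i ⟧)))
  where
  pointwise : ∀ i → ⟦ V i ∧ g i ⟧ ≡ ⟦ b ⟧ * ⟦ V i ⟧
  pointwise i with V i in Vi
  ... | true = trans (cong ⟦_⟧ (const i Vi)) (sym (*-identityʳ ⟦ b ⟧))
  ... | false = sym (*-zeroʳ ⟦ b ⟧)

countIn-cong : {V : VSet n} {g h : Fin n → Bool} → (∀ i → V i ≡ true → g i ≡ h i) → countIn V g ≡ countIn V h
countIn-cong {V = V} {g} {h} agree = sum-cong-≗ pointwise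
  where
  pointwise : ∀ i → ⟦ V i ∧ g i ⟧ ≡ ⟦ V i ∧ h i ⟧
  pointwise i with V i in Vi
  ... | true = cong ⟦_⟧ (agree i Vi)
  ... | false = refl

count-nonzero : (V : VSet n) → count V ≢ 0 → ∃ λ i → V i ≡ true
count-nonzero {zero} V h = ⊥-elim (h refl)
count-nonzero {suc n} V h with V zero in V0
... | true = zero , V0
... | false with count-nonzero (λ i → V (suc i)) h
...   | i , Vi = suc i , Vi

count-positive : (V : VSet n) {i : Fin n} → V i ≡ true → 1 ≤ count V
count-positive V {zero} Vi rewrite Vi = s≤s z≤n
count-positive V {suc i} Vi = ≤-trans (count-positive (λ j → V (suc j)) Vi) (m≤n+m _ ⟦ V zero ⟧)

count-∖-< : {V W : VSet n} → W ⊆ V → {i : Fin n} → V i ≡ true → W i ≡ false → count W < count V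
count-∖-< {V = V} {W} W⊆V {i} Vi Wi = subst (count W <_) (sym (count-∖ W⊆V)) (m<m+n (count W) witness)
  where
  witness : 1 ≤ count (V ∖ W)
  witness = count-positive (V ∖ W) (subst (λ b → V i ∧ not b ≡ true) (sym Wi) (trans (∧-identityʳ (V i)) Vi))

count-all : count {n} (λ _ → true) ≡ n
count-all {zero} = refl
count-all {suc n} = cong suc (count-all {n})

handshake : (F : Fin n → Fin n → ℕ) → (∀ x y → F x y ≡ F y x) → (∀ x → F x x ≡ 0) →
            ∃ λ h → sum (λ x → sum (F x)) ≡ h + h
handshake {zero} F symmetric diagonal = 0 , refl
handshake {suc n} F symmetric diagonal
  with handshake (λ x y → F (suc x) (suc y)) (λ x y → symmetric (suc x) (suc y)) (λ x → diagonal (suc x))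
... | h , inner = r + h , total
  where
  r : ℕ
  r = sum (λ y → F zero (suc y))
  column : ℕ
  column = sum (λ x → F (suc x) zero)
  total : (F zero zero + r) + sum (λ x → F (suc x) zero + sum (λ y → F (suc x) (suc y))) ≡ (r + h) + (r + h)
  total = begin
    (F zero zero + r) + sum (λ x → F (suc x) zero + sum (λ y → F (suc x) (suc y)))
      ≡⟨ cong₂ _+_ (cong (_+ r) (diagonal zero)) (∑-distrib-+ (λ x → F (suc x) zero) (λ x → sum (λ y → F (suc x) (suc y)))) ⟩
    r + (column + sum (λ x → sum (λ y → F (suc x) (suc y))))
      ≡⟨ cong₂ (λ c t → r + (c + t)) (sum-cong-≗ (λ x → symmetric (suc x) zero)) inner ⟩
    r + (r + (h + h))
      ≡⟨ regroup r h ⟩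
    (r + h) + (r + h) ∎
    where
    open ≡-Reasoning
    regroup : ∀ a b → a + (a + (b + b)) ≡ (a + b) + (a + b)
    regroup = solve-∀

ℤ₄ : Set
ℤ₄ = Fin 4

suc₄ : ℤ₄ → ℤ₄
suc₄ 0F = 1F
suc₄ 1F = 2F
suc₄ 2F = 3F
suc₄ 3F = 0F

infixl 6 _+₄_
infixl 7 _*₄_

_+₄_ : ℤ₄ → ℤ₄ → ℤ₄
0F +₄ b = b
1F +₄ b = suc₄ b
2F +₄ b = suc₄ (suc₄ b)
3F +₄ b = suc₄ (suc₄ (suc₄ b))

_*₄_ : ℤ₄ → ℤ₄ → ℤ₄
0F *₄ b = 0F
1F *₄ b = b
2F *₄ b = b +₄ b
3F *₄ b = b +₄ b +₄ b

[_] : ℕ → ℤ₄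
[ zero ] = 0F
[ suc m ] = suc₄ [ m ]

odd₄ : ℤ₄ → Bool
odd₄ 0F = false
odd₄ 1F = true
odd₄ 2F = false
odd₄ 3F = true

[+] : ∀ m n → [ m + n ] ≡ [ m ] +₄ [ n ]
[+] zero n = refl
[+] (suc m) n = trans (cong suc₄ ([+] m n)) (sym (suc₄-+₄ [ m ] [ n ]))
  where
  suc₄-+₄ : ∀ a b → suc₄ a +₄ b ≡ suc₄ (a +₄ b)
  suc₄-+₄ = from-yes (all? λ a → all? λ b → suc₄ a +₄ b ≟ suc₄ (a +₄ b))

[*] : ∀ m n → [ m * n ] ≡ [ m ] *₄ [ n ]
[*] zero n = refl
[*] (suc m) n = trans ([+] n (m * n)) (trans (cong ([ n ] +₄_) ([*] m n)) (suc₄-*₄ [ m ] [ n ]))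
  where
  suc₄-*₄ : ∀ a b → b +₄ a *₄ b ≡ suc₄ a *₄ b
  suc₄-*₄ = from-yes (all? λ a → all? λ b → b +₄ a *₄ b ≟ suc₄ a *₄ b)

[m]≡[m%4] : ∀ m → [ m ] ≡ [ m % 4 ]
[m]≡[m%4] m = begin
  [ m ]                           ≡⟨ cong [_] (m≡m%n+[m/n]*n m 4) ⟩
  [ m % 4 + (m / 4) * 4 ]         ≡⟨ [+] (m % 4) ((m / 4) * 4) ⟩
  [ m % 4 ] +₄ [ (m / 4) * 4 ]    ≡⟨ cong ([ m % 4 ] +₄_) ([*] (m / 4) 4) ⟩
  [ m % 4 ] +₄ [ m / 4 ] *₄ 0F    ≡⟨ vanish [ m % 4 ] [ m / 4 ] ⟩
  [ m % 4 ]                       ∎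
  where
  open ≡-Reasoning
  vanish : ∀ a b → a +₄ b *₄ 0F ≡ a
  vanish = from-yes (all? λ a → all? λ b → a +₄ b *₄ 0F ≟ a)

odd : ℕ → Bool
odd m = odd₄ [ m ]

odd≡odd[m%2] : ∀ m → odd m ≡ odd (m % 2)
odd≡odd[m%2] m = begin
  odd₄ [ m ]                             ≡⟨ cong (λ t → odd₄ [ t ]) (m≡m%n+[m/n]*n m 2) ⟩
  odd₄ [ m % 2 + (m / 2) * 2 ]           ≡⟨ cong odd₄ (trans ([+] (m % 2) ((m / 2) * 2)) (cong ([ m % 2 ] +₄_) ([*] (m / 2) 2))) ⟩
  odd₄ ([ m % 2 ] +₄ [ m / 2 ] *₄ 2F)    ≡⟨ even-shift [ m % 2 ] [ m / 2 ] ⟩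
  odd₄ [ m % 2 ]                         ∎
  where
  open ≡-Reasoning
  even-shift : ∀ a b → odd₄ (a +₄ b *₄ 2F) ≡ odd₄ a
  even-shift = from-yes (all? λ a → all? λ b → odd₄ (a +₄ b *₄ 2F) ≟ᵇ odd₄ a)

odd-+ : ∀ m n → odd (m + n) ≡ odd m xor odd n
odd-+ m n = trans (cong odd₄ ([+] m n)) (odd₄-+₄ [ m ] [ n ])
  where
  odd₄-+₄ : ∀ a b → odd₄ (a +₄ b) ≡ odd₄ a xor odd₄ b
  odd₄-+₄ = from-yes (all? λ a → all? λ b → odd₄ (a +₄ b) ≟ᵇ odd₄ a xor odd₄ b)

odd-* : ∀ m n → odd (m * n) ≡ odd m ∧ odd n
odd-* m n = trans (cong odd₄ ([*] m n)) (odd₄-*₄ [ m ] [ n ])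
  where
  odd₄-*₄ : ∀ a b → odd₄ (a *₄ b) ≡ odd₄ a ∧ odd₄ b
  odd₄-*₄ = from-yes (all? λ a → all? λ b → odd₄ (a *₄ b) ≟ᵇ odd₄ a ∧ odd₄ b)

odd-⟦⟧ : ∀ b → odd ⟦ b ⟧ ≡ b
odd-⟦⟧ true = refl
odd-⟦⟧ false = refl

even-+ˡ : ∀ a b → odd a ≡ false → odd (a + b) ≡ odd b
even-+ˡ a b even = trans (odd-+ a b) (cong (_xor odd b) even)

even-+ʳ : ∀ a b → odd b ≡ false → odd (a + b) ≡ odd a
even-+ʳ a b even = trans (odd-+ a b) (trans (cong (odd a xor_) even) (xor-identityʳ (odd a)))

*-even : ∀ c m → odd m ≡ false → odd (c * m) ≡ false
*-even c m even = trans (odd-* c m) (trans (cong (odd c ∧_) even) (∧-zeroʳ (odd c)))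

odd-difference : ∀ r m → odd (r + m) ≡ true → odd r ≡ true → odd m ≡ false
odd-difference r m odd-sum odd-r = trans (sym (not-involutive (odd m))) (cong not not-odd-m)
  where
  not-odd-m : not (odd m) ≡ true
  not-odd-m = trans (sym (trans (odd-+ r m) (cong (_xor odd m) odd-r))) odd-sum

odd-sum : (U : VSet n) (f : Fin n → ℕ) → (∀ x → U x ≡ true → odd (f x) ≡ true) →
  odd (sum (λ x → ⟦ U x ⟧ * f x)) ≡ odd (count U)
odd-sum {zero} U f oddF = refl
odd-sum {suc n} U f oddF = begin
  odd (⟦ U zero ⟧ * f zero + sum (λ x → ⟦ U (suc x) ⟧ * f (suc x)))
    ≡⟨ odd-+ (⟦ U zero ⟧ * f zero) _ ⟩
  odd (⟦ U zero ⟧ * f zero) xor odd (sum (λ x → ⟦ U (suc x) ⟧ * f (suc x)))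
    ≡⟨ cong₂ _xor_ (first (U zero) refl) (odd-sum (λ x → U (suc x)) (λ x → f (suc x)) (λ x → oddF (suc x))) ⟩
  odd ⟦ U zero ⟧ xor odd (count (λ x → U (suc x)))
    ≡⟨ sym (odd-+ ⟦ U zero ⟧ _) ⟩
  odd (count U) ∎
  where
  open ≡-Reasoning
  first : ∀ b → U zero ≡ b → odd (⟦ b ⟧ * f zero) ≡ odd ⟦ b ⟧
  first true U0 = trans (odd-* 1 (f zero)) (oddF zero U0)
  first false U0 = refl

corner-parity : ∀ a R M → odd ((1 + R) + M) ≡ true → odd ((0 + ⟦ not a ⟧ * R) + ⟦ a ⟧ * M) ≡ true →
  odd R ≡ true
corner-parity a R M odd-size odd-deg =
  solve a (odd R) (odd M) (trans (sym (trans (odd-+ (1 + R) M) (cong (_xor odd M) (odd-+ 1 R)))) odd-size) (trans (sym degree-parity) odd-deg)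
  where
  degree-parity : odd ((0 + ⟦ not a ⟧ * R) + ⟦ a ⟧ * M) ≡ (not a ∧ odd R) xor (a ∧ odd M)
  degree-parity = trans (odd-+ (⟦ not a ⟧ * R) (⟦ a ⟧ * M))
    (cong₂ _xor_ (trans (odd-* ⟦ not a ⟧ R) (cong (_∧ odd R) (odd-⟦⟧ (not a))))
                 (trans (odd-* ⟦ a ⟧ M) (cong (_∧ odd M) (odd-⟦⟧ a))))
  solve : ∀ a r m → not r xor m ≡ true → (not a ∧ r) xor (a ∧ m) ≡ true → r ≡ true
  solve false true m s d = refl
  solve true true m s d = refl
  solve false false m s ()
  solve true false true () d
  solve true false false s ()

odd-not-1 : ∀ a → odd₄ a ≡ true → a ≢ 1F → suc₄ a ≡ 0F
odd-not-1 1F odd-a a≢1 = ⊥-elim (a≢1 refl)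
odd-not-1 3F odd-a a≢1 = refl

mod4-obstruction : ∀ a t h k j → a + a ≡ t + 2 * (h + h) → t + (k + j) ≡ k * k + j * j → [ k + j ] ≡ 1F →
  odd a ≡ false
mod4-obstruction a t h k j e₁ e₂ e₃ = from-yes
  (all? λ k′ → all? λ j′ → (k′ +₄ j′ ≟ 1F) →-dec
   all? λ t′ → (t′ +₄ (k′ +₄ j′) ≟ k′ *₄ k′ +₄ j′ *₄ j′) →-dec
   all? λ a′ → all? λ h′ → (a′ +₄ a′ ≟ t′ +₄ 2F *₄ (h′ +₄ h′)) →-dec (odd₄ a′ ≟ᵇ false))
  [ k ] [ j ] (trans (sym ([+] k j)) e₃) [ t ] reduced₂ [ a ] [ h ] reduced₁
  where
  reduced₁ : [ a ] +₄ [ a ] ≡ [ t ] +₄ 2F *₄ ([ h ] +₄ [ h ])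
  reduced₁ = begin
    [ a ] +₄ [ a ]                     ≡⟨ sym ([+] a a) ⟩
    [ a + a ]                          ≡⟨ cong [_] e₁ ⟩
    [ t + 2 * (h + h) ]                ≡⟨ [+] t (2 * (h + h)) ⟩
    [ t ] +₄ [ 2 * (h + h) ]           ≡⟨ cong ([ t ] +₄_) (trans ([*] 2 (h + h)) (cong (2F *₄_) ([+] h h))) ⟩
    [ t ] +₄ 2F *₄ ([ h ] +₄ [ h ])    ∎
    where open ≡-Reasoning
  reduced₂ : [ t ] +₄ ([ k ] +₄ [ j ]) ≡ [ k ] *₄ [ k ] +₄ [ j ] *₄ [ j ]
  reduced₂ = begin
    [ t ] +₄ ([ k ] +₄ [ j ])          ≡⟨ cong ([ t ] +₄_) (sym ([+] k j)) ⟩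
    [ t ] +₄ [ k + j ]                 ≡⟨ sym ([+] t (k + j)) ⟩
    [ t + (k + j) ]                    ≡⟨ cong [_] e₂ ⟩
    [ k * k + j * j ]                  ≡⟨ trans ([+] (k * k) (j * j)) (cong₂ _+₄_ ([*] k k) ([*] j j)) ⟩
    [ k ] *₄ [ k ] +₄ [ j ] *₄ [ j ]   ∎
    where open ≡-Reasoning

Adj : ℕ → Set
Adj k = Fin k → Fin k → Bool

asym : Adj k → Fin k → Fin k → Bool
asym M i j = M i j xor M j i

pairs : VSet n → (Fin n → Fin n → Bool) → ℕ
pairs U R = sum (λ x → sum (λ y → ⟦ U x ∧ (U y ∧ R x y) ⟧))

pairs-flip : (U : VSet n) (R : Fin n → Fin n → Bool) → pairs U R ≡ pairs U (λ x y → R y x)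
pairs-flip U R = trans (∑-comm (λ x y → ⟦ U x ∧ (U y ∧ R x y) ⟧))
                       (sum-cong-≗ (λ y → sum-cong-≗ (λ x → cong ⟦_⟧ (swap (U x) (U y) (R x y)))))
  where
  swap : ∀ a b c → a ∧ (b ∧ c) ≡ b ∧ (a ∧ c)
  swap true b c = refl
  swap false true c = refl
  swap false false c = refl

-- Each arc lies in a unique ordered pair; each asymmetric pair is counted once in each order,
-- and each mutual pair twice in each order.
pairs-double : (U : VSet n) (A : Adj n) →
  pairs U A + pairs U A ≡ pairs U (asym A) + 2 * pairs U (λ x y → A x y ∧ A y x)
pairs-double {n} U A = begin
  pairs U A + pairs U A
    ≡⟨ cong (pairs U A +_) (pairs-flip U A) ⟩
  pairs U A + pairs U (λ x y → A y x)
    ≡⟨ sym (∑∑-+ (λ x y → ⟦ U x ∧ (U y ∧ A x y) ⟧) (λ x y → ⟦ U x ∧ (U y ∧ A y x) ⟧)) ⟩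
  sum (λ x → sum (λ y → ⟦ U x ∧ (U y ∧ A x y) ⟧ + ⟦ U x ∧ (U y ∧ A y x) ⟧))
    ≡⟨ sum-cong-≗ (λ x → sum-cong-≗ (λ y → pointwise (U x) (U y) (A x y) (A y x))) ⟩
  sum (λ x → sum (λ y → ⟦ U x ∧ (U y ∧ asym A x y) ⟧ + 2 * ⟦ U x ∧ (U y ∧ (A x y ∧ A y x)) ⟧))
    ≡⟨ ∑∑-+ (λ x y → ⟦ U x ∧ (U y ∧ asym A x y) ⟧) (λ x y → 2 * ⟦ U x ∧ (U y ∧ (A x y ∧ A y x)) ⟧) ⟩
  pairs U (asym A) + sum (λ x → sum (λ y → 2 * ⟦ U x ∧ (U y ∧ (A x y ∧ A y x)) ⟧))
    ≡⟨ cong (pairs U (asym A) +_) (sym (trans (*-distribˡ-sum 2 (λ x → sum (λ y → ⟦ U x ∧ (U y ∧ (A x y ∧ A y x)) ⟧)))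
                                            (sum-cong-≗ (λ x → *-distribˡ-sum 2 (λ y → ⟦ U x ∧ (U y ∧ (A x y ∧ A y x)) ⟧))))) ⟩
  pairs U (asym A) + 2 * pairs U (λ x y → A x y ∧ A y x) ∎
  where
  open ≡-Reasoning
  ∑∑-+ : (f g : Fin n → Fin n → ℕ) →
         sum (λ x → sum (λ y → f x y + g x y)) ≡ sum (λ x → sum (f x)) + sum (λ x → sum (g x))
  ∑∑-+ f g = trans (sum-cong-≗ (λ x → ∑-distrib-+ (f x) (g x))) (∑-distrib-+ (λ x → sum (f x)) (λ x → sum (g x)))
  pointwise : ∀ u v a b →
    ⟦ u ∧ (v ∧ a) ⟧ + ⟦ u ∧ (v ∧ b) ⟧ ≡ ⟦ u ∧ (v ∧ (a xor b)) ⟧ + 2 * ⟦ u ∧ (v ∧ (a ∧ b)) ⟧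
  pointwise true true true true = refl
  pointwise true true true false = refl
  pointwise true true false true = refl
  pointwise true true false false = refl
  pointwise true false a b = refl
  pointwise false v a b = refl

deg : Digraph n → VSet n → Fin n → ℕ
deg D U u = countIn U (adj D u)

AllOdd : Digraph n → VSet n → Set
AllOdd D U = ∀ u → U u ≡ true → odd (deg D U u) ≡ true

parity-peel : {V B : VSet n} {g : Fin n → Bool} (b : Bool) → B ⊆ V → (∀ i → B i ≡ true → g i ≡ b) →
  odd (count B) ≡ false → odd (countIn V g) ≡ odd (countIn (V ∖ B) g)
parity-peel {V = V} {B} {g} b B⊆V constant even = begin
  odd (countIn V g)                                  ≡⟨ cong odd (countIn-∖ B⊆V g) ⟩
  odd (countIn B g + countIn (V ∖ B) g)              ≡⟨ cong (λ c → odd (c + countIn (V ∖ B) g)) (countIn-const b constant) ⟩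
  odd (⟦ b ⟧ * count B + countIn (V ∖ B) g)
    ≡⟨ even-+ˡ (⟦ b ⟧ * count B) (countIn (V ∖ B) g) (*-even ⟦ b ⟧ (count B) even) ⟩
  odd (countIn (V ∖ B) g)                            ∎
  where open ≡-Reasoning

-- Small configurations are adjacency matrices on Fin k; loops are ignored.
outdeg : Adj k → Fin k → ℕ
outdeg M j = count (λ l → not (l == j) ∧ M j l)

oddCount : Adj k → ℕ
oddCount M = count (λ j → isOdd (outdeg M j))

_⟨_⟩ : ∀ {m} → Adj k → Vector (Fin k) m → Adj m
M ⟨ t ⟩ = λ j l → M (t j) (t l)

Distinct : Vector (Fin n) k → Set
Distinct v = ∀ j l → v j ≡ v l → j ≡ l

distinct? : (v : Vector (Fin n) k) → Dec (Distinct v)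
distinct? v = all? λ j → all? λ l → (v j ≟ v l) →-dec (j ≟ l)

distinct-∷ : {v : Vector (Fin n) k} {a : Fin n} → (∀ j → v j ≢ a) → Distinct v → Distinct (a ∷ v)
distinct-∷ fresh d zero zero e = refl
distinct-∷ fresh d zero (suc l) e = ⊥-elim (fresh l (sym e))
distinct-∷ fresh d (suc j) zero e = ⊥-elim (fresh j e)
distinct-∷ fresh d (suc j) (suc l) e = cong suc (d j l e)

distinct-∘ : ∀ {m} {v : Vector (Fin n) k} {t : Vector (Fin k) m} → Distinct v → Distinct t → Distinct (λ j → v (t j))
distinct-∘ {t = t} dv dt j l e = dt j l (dv (t j) (t l) e)

∀ᵇ? : {P : Bool → Set} → (∀ b → Dec (P b)) → Dec (∀ b → P b)
∀ᵇ? P? = map′ (λ (p , q) → λ { true → p ; false → q }) (λ h → h true , h false) (P? true ×-dec P? false)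

good3 : Adj 3 → Bool
good3 M = not (oddCount M ≡ᵇ 2)

triangles4 : Vector (Vector (Fin 4) 3) 4
triangles4 = (0F ∷ 1F ∷ 2F ∷ []) ∷ (0F ∷ 1F ∷ 3F ∷ []) ∷ (0F ∷ 2F ∷ 3F ∷ []) ∷ (1F ∷ 2F ∷ 3F ∷ []) ∷ []

triangles5 : Vector (Vector (Fin 5) 3) 10
triangles5 = (0F ∷ 1F ∷ 2F ∷ []) ∷ (0F ∷ 1F ∷ 3F ∷ []) ∷ (0F ∷ 1F ∷ 4F ∷ []) ∷ (0F ∷ 2F ∷ 3F ∷ [])
           ∷ (0F ∷ 2F ∷ 4F ∷ []) ∷ (0F ∷ 3F ∷ 4F ∷ []) ∷ (1F ∷ 2F ∷ 3F ∷ []) ∷ (1F ∷ 2F ∷ 4F ∷ [])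
           ∷ (1F ∷ 3F ∷ 4F ∷ []) ∷ (2F ∷ 3F ∷ 4F ∷ []) ∷ []

⋀ : ∀ {m} → Vector Bool m → Bool
⋀ = foldr _∧_ true

good4 : Adj 4 → Bool
good4 M = ⋀ (λ i → good3 (M ⟨ triangles4 i ⟩))

good5 : Adj 5 → Bool
good5 M = ⋀ (λ i → good3 (M ⟨ triangles5 i ⟩)) ∧ not (oddCount M ≡ᵇ 3)

parity3 : Adj k → Fin k → Fin k → Fin k → Bool
parity3 M x y z = asym M x y xor asym M y z xor asym M z x

matrix3 : (a01 a02 a10 a12 a20 a21 : Bool) → Adj 3
matrix3 a01 a02 a10 a12 a20 a21 =
  (false ∷ a01 ∷ a02 ∷ []) ∷ (a10 ∷ false ∷ a12 ∷ []) ∷ (a20 ∷ a21 ∷ false ∷ []) ∷ []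

-- Vertices 0, 1, 2 of a configuration form a uniform triangle if each of them sends the same
-- arc to both others; its reference arcs are 0→1, 1→2 and 2→0.
Uniform : Adj (3 + k) → Set
Uniform M = (M 0F 2F ≡ M 0F 1F) × (M 1F 0F ≡ M 1F 2F) × (M 2F 1F ≡ M 2F 0F)

separates : Adj k → Fin k → Fin k → Fin k → Bool
separates M c c' v = M c v xor M c c'

even-triangle-uniform : (M : Adj 3) → good3 M ≡ true → parity3 M 0F 1F 2F ≡ false → Uniform M
even-triangle-uniform M = from-yes
  (∀ᵇ? λ a01 → ∀ᵇ? λ a02 → ∀ᵇ? λ a10 → ∀ᵇ? λ a12 → ∀ᵇ? λ a20 → ∀ᵇ? λ a21 →
    let N = matrix3 a01 a02 a10 a12 a20 a21 in
    (good3 N ≟ᵇ true) →-dec (parity3 N 0F 1F 2F ≟ᵇ false) →-dec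
    ((a02 ≟ᵇ a01) ×-dec (a10 ≟ᵇ a12) ×-dec (a21 ≟ᵇ a20)))
  (M 0F 1F) (M 0F 2F) (M 1F 0F) (M 1F 2F) (M 2F 0F) (M 2F 1F)

matrix4 : (a01 a02 a03 a10 a12 a13 a20 a21 a23 a30 a31 a32 : Bool) → Adj 4
matrix4 a01 a02 a03 a10 a12 a13 a20 a21 a23 a30 a31 a32 =
    (false ∷ a01 ∷ a02 ∷ a03 ∷ [])
  ∷ (a10 ∷ false ∷ a12 ∷ a13 ∷ [])
  ∷ (a20 ∷ a21 ∷ false ∷ a23 ∷ [])
  ∷ (a30 ∷ a31 ∷ a32 ∷ false ∷ [])
  ∷ []

separated-vertex : (M : Adj 4) → good4 M ≡ true → Uniform M → separates M 0F 1F 3F ≡ true →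
  (separates M 1F 2F 3F ≡ false) × (M 3F 1F ≡ M 3F 0F) × (M 3F 2F ≡ M 3F 0F)
separated-vertex M good (u0 , u1 , u2) s = from-yes
  (∀ᵇ? λ a01 → ∀ᵇ? λ a02 → (a02 ≟ᵇ a01) →-dec
   ∀ᵇ? λ a10 → ∀ᵇ? λ a12 → (a10 ≟ᵇ a12) →-dec
   ∀ᵇ? λ a20 → ∀ᵇ? λ a21 → (a21 ≟ᵇ a20) →-dec
   ∀ᵇ? λ a03 → (a03 xor a01 ≟ᵇ true) →-dec
   ∀ᵇ? λ a13 → ∀ᵇ? λ a23 → ∀ᵇ? λ a30 → ∀ᵇ? λ a31 → ∀ᵇ? λ a32 →
    (good4 (matrix4 a01 a02 a03 a10 a12 a13 a20 a21 a23 a30 a31 a32) ≟ᵇ true) →-dec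
    ((a13 xor a12 ≟ᵇ false) ×-dec (a31 ≟ᵇ a30) ×-dec (a32 ≟ᵇ a30)))
  (M 0F 1F) (M 0F 2F) u0 (M 1F 0F) (M 1F 2F) u1 (M 2F 0F) (M 2F 1F) u2 (M 0F 3F) s
  (M 1F 3F) (M 2F 3F) (M 3F 0F) (M 3F 1F) (M 3F 2F) good

matrix5 : (a01 a02 a03 a04 a10 a12 a13 a14 a20 a21 a23 a24 a30 a31 a32 a34 a40 a41 a42 a43 : Bool) → Adj 5
matrix5 a01 a02 a03 a04 a10 a12 a13 a14 a20 a21 a23 a24 a30 a31 a32 a34 a40 a41 a42 a43 =
    (false ∷ a01 ∷ a02 ∷ a03 ∷ a04 ∷ [])
  ∷ (a10 ∷ false ∷ a12 ∷ a13 ∷ a14 ∷ [])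
  ∷ (a20 ∷ a21 ∷ false ∷ a23 ∷ a24 ∷ [])
  ∷ (a30 ∷ a31 ∷ a32 ∷ false ∷ a34 ∷ [])
  ∷ (a40 ∷ a41 ∷ a42 ∷ a43 ∷ false ∷ [])
  ∷ []

separated-to-unseparated : (M : Adj 5) → good5 M ≡ true → Uniform M →
  separates M 0F 1F 3F ≡ true → separates M 0F 1F 4F ≡ false → M 3F 4F ≡ M 3F 0F
separated-to-unseparated M good (u0 , u1 , u2) s3 s4 = from-yes
  (∀ᵇ? λ a01 → ∀ᵇ? λ a02 → (a02 ≟ᵇ a01) →-dec
   ∀ᵇ? λ a10 → ∀ᵇ? λ a12 → (a10 ≟ᵇ a12) →-dec
   ∀ᵇ? λ a20 → ∀ᵇ? λ a21 → (a21 ≟ᵇ a20) →-dec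
   ∀ᵇ? λ a03 → (a03 xor a01 ≟ᵇ true) →-dec
   ∀ᵇ? λ a04 → (a04 xor a01 ≟ᵇ false) →-dec
   ∀ᵇ? λ a13 → ∀ᵇ? λ a14 → ∀ᵇ? λ a23 → ∀ᵇ? λ a24 → ∀ᵇ? λ a30 → ∀ᵇ? λ a31 →
   ∀ᵇ? λ a32 → ∀ᵇ? λ a34 → ∀ᵇ? λ a40 → ∀ᵇ? λ a41 → ∀ᵇ? λ a42 → ∀ᵇ? λ a43 →
    (good5 (matrix5 a01 a02 a03 a04 a10 a12 a13 a14 a20 a21 a23 a24 a30 a31 a32 a34 a40 a41 a42 a43) ≟ᵇ true)
    →-dec (a34 ≟ᵇ a30))
  (M 0F 1F) (M 0F 2F) u0 (M 1F 0F) (M 1F 2F) u1 (M 2F 0F) (M 2F 1F) u2 (M 0F 3F) s3 (M 0F 4F) s4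
  (M 1F 3F) (M 1F 4F) (M 2F 3F) (M 2F 4F) (M 3F 0F) (M 3F 1F) (M 3F 2F) (M 3F 4F)
  (M 4F 0F) (M 4F 1F) (M 4F 2F) (M 4F 3F) good

unseparated-to-separated : (M : Adj 5) → good5 M ≡ true → Uniform M →
  separates M 0F 1F 3F ≡ false → separates M 1F 2F 3F ≡ false → separates M 2F 0F 3F ≡ false →
  separates M 0F 1F 4F ≡ true → M 3F 4F ≡ M 3F 0F
unseparated-to-separated M good (u0 , u1 , u2) s03 s13 s23 s04 = from-yes
  (∀ᵇ? λ a01 → ∀ᵇ? λ a02 → (a02 ≟ᵇ a01) →-dec
   ∀ᵇ? λ a10 → ∀ᵇ? λ a12 → (a10 ≟ᵇ a12) →-dec
   ∀ᵇ? λ a20 → ∀ᵇ? λ a21 → (a21 ≟ᵇ a20) →-dec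
   ∀ᵇ? λ a03 → (a03 xor a01 ≟ᵇ false) →-dec
   ∀ᵇ? λ a13 → (a13 xor a12 ≟ᵇ false) →-dec
   ∀ᵇ? λ a23 → (a23 xor a20 ≟ᵇ false) →-dec
   ∀ᵇ? λ a04 → (a04 xor a01 ≟ᵇ true) →-dec
   ∀ᵇ? λ a14 → ∀ᵇ? λ a24 → ∀ᵇ? λ a30 → ∀ᵇ? λ a31 → ∀ᵇ? λ a32 → ∀ᵇ? λ a34 →
   ∀ᵇ? λ a40 → ∀ᵇ? λ a41 → ∀ᵇ? λ a42 → ∀ᵇ? λ a43 →
    (good5 (matrix5 a01 a02 a03 a04 a10 a12 a13 a14 a20 a21 a23 a24 a30 a31 a32 a34 a40 a41 a42 a43) ≟ᵇ true)
    →-dec (a34 ≟ᵇ a30))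
  (M 0F 1F) (M 0F 2F) u0 (M 1F 0F) (M 1F 2F) u1 (M 2F 0F) (M 2F 1F) u2 (M 0F 3F) s03 (M 1F 3F) s13
  (M 2F 3F) s23 (M 0F 4F) s04 (M 1F 4F) (M 2F 4F) (M 3F 0F) (M 3F 1F) (M 3F 2F) (M 3F 4F)
  (M 4F 0F) (M 4F 1F) (M 4F 2F) (M 4F 3F) good

NoBad3 : Digraph n → Set
NoBad3 {n} D = (t : Vector (Fin n) 3) → Distinct t → oddCount (adj D ⟨ t ⟩) ≢ 2

NoBad5 : Digraph n → Set
NoBad5 {n} D = (t : Vector (Fin n) 5) → Distinct t → oddCount (adj D ⟨ t ⟩) ≢ 3

not-≡ᵇ : ∀ {a b} → a ≢ b → not (a ≡ᵇ b) ≡ true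
not-≡ᵇ {a} {b} a≢b with a ≡ᵇ b in e
... | true = ⊥-elim (a≢b (≡ᵇ⇒≡ a b (subst T (sym e) tt)))
... | false = refl

⋀-intro : ∀ {m} (b : Vector Bool m) → (∀ i → b i ≡ true) → ⋀ b ≡ true
⋀-intro {zero} b all = refl
⋀-intro {suc m} b all = cong₂ _∧_ (all zero) (⋀-intro (λ i → b (suc i)) (λ i → all (suc i)))

good3-induced : {D : Digraph n} → NoBad3 D → {t : Vector (Fin n) 3} → Distinct t → good3 (adj D ⟨ t ⟩) ≡ true
good3-induced noBad3 dt = not-≡ᵇ (noBad3 _ dt)

good-triangles : ∀ {m} {D : Digraph n} → NoBad3 D → {v : Vector (Fin n) k} → Distinct v →
  (ts : Vector (Vector (Fin k) 3) m) → (∀ i → Distinct (ts i)) → ⋀ (λ i → good3 (adj D ⟨ v ⟩ ⟨ ts i ⟩)) ≡ true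
good-triangles {D = D} noBad3 {v} dv ts dts =
  ⋀-intro _ (λ i → good3-induced {D = D} noBad3 {λ j → v (ts i j)} (distinct-∘ {v = v} {t = ts i} dv (dts i)))

good4-induced : {D : Digraph n} → NoBad3 D → {v : Vector (Fin n) 4} → Distinct v → good4 (adj D ⟨ v ⟩) ≡ true
good4-induced {D = D} noBad3 {v} dv =
  good-triangles {D = D} noBad3 {v} dv triangles4 (from-yes (all? λ i → distinct? (triangles4 i)))

good5-induced : {D : Digraph n} → NoBad3 D → NoBad5 D → {v : Vector (Fin n) 5} → Distinct v →
  good5 (adj D ⟨ v ⟩) ≡ true
good5-induced {D = D} noBad3 noBad5 {v} dv =
  cong₂ _∧_ (good-triangles {D = D} noBad3 {v} dv triangles5 (from-yes (all? λ i → distinct? (triangles5 i))))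
            (not-≡ᵇ (noBad5 v dv))

image : Vector (Fin n) k → VSet n
image {k = zero} t i = false
image {k = suc k} t i = (i == t zero) ∨ image (λ j → t (suc j)) i

image-entry : (t : Vector (Fin n) k) {i : Fin n} → image t i ≡ true → ∃ λ j → t j ≡ i
image-entry {k = suc k} t {i} h with i ≟ t zero
... | yes i≡t0 = zero , sym i≡t0
... | no _ with image-entry (λ j → t (suc j)) h
...   | j , tj≡i = suc j , tj≡i

countIn-image : {t : Vector (Fin n) k} → Distinct t → (g : Fin n → Bool) →
  countIn (image t) g ≡ sum (λ j → ⟦ g (t j) ⟧)
countIn-image {n = n} {k = zero} {t} dt g = sum-replicate-zero n
countIn-image {n = n} {k = suc k} {t} dt g = begin
  sum (λ i → ⟦ ((i == t zero) ∨ rest i) ∧ g i ⟧)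
    ≡⟨ sum-cong-≗ {n} split ⟩
  sum (λ i → ⟦ (i == t zero) ∧ g i ⟧ + ⟦ rest i ∧ g i ⟧)
    ≡⟨ ∑-distrib-+ (λ i → ⟦ (i == t zero) ∧ g i ⟧) (λ i → ⟦ rest i ∧ g i ⟧) ⟩
  countIn ⁅ t zero ⁆ g + countIn rest g
    ≡⟨ cong₂ _+_ (countIn-⁅⁆ (t zero) g)
                 (countIn-image {t = λ j → t (suc j)} (λ j l e → suc-injective (dt (suc j) (suc l) e)) g) ⟩
  ⟦ g (t zero) ⟧ + sum (λ j → ⟦ g (t (suc j)) ⟧) ∎
  where
  open ≡-Reasoning
  rest : VSet n
  rest = image (λ j → t (suc j))
  split : ∀ i → ⟦ ((i == t zero) ∨ rest i) ∧ g i ⟧ ≡ ⟦ (i == t zero) ∧ g i ⟧ + ⟦ rest i ∧ g i ⟧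
  split i with i ≟ t zero
  ... | no _ = refl
  ... | yes refl with rest (t zero) in r
  ...   | false = sym (+-identityʳ _)
  ...   | true with image-entry (λ j → t (suc j)) r
  ...     | j , e with dt (suc j) zero e
  ...       | ()

∣tabulate∣ : (P : VSet n) → ∣ tabulate P ∣ ≡ count P
∣tabulate∣ {zero} P = refl
∣tabulate∣ {suc n} P with P zero
... | true = cong suc (∣tabulate∣ (λ i → P (suc i)))
... | false = ∣tabulate∣ (λ i → P (suc i))

tabulate-∩ : (P Q : VSet n) → tabulate P ∩ tabulate Q ≡ tabulate (λ i → P i ∧ Q i)
tabulate-∩ {zero} P Q = refl
tabulate-∩ {suc n} P Q = cong (P zero ∧ Q zero ∷ᵛ_) (tabulate-∩ (λ i → P (suc i)) (λ i → Q (suc i)))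

∣image∣ : {t : Vector (Fin n) k} → Distinct t → ∣ tabulate (image t) ∣ ≡ k
∣image∣ {k = k} {t} dt = begin
  ∣ tabulate (image t) ∣               ≡⟨ ∣tabulate∣ (image t) ⟩
  count (image t)                      ≡⟨ count-as-countIn (image t) ⟩
  countIn (image t) (λ _ → true)       ≡⟨ countIn-image {t = t} dt (λ _ → true) ⟩
  count {k} (λ _ → true)               ≡⟨ count-all ⟩
  k                                    ∎
  where open ≡-Reasoning

∣oddVertices-image∣ : (D : Digraph n) {t : Vector (Fin n) k} → Distinct t →
  ∣ oddVerticesIn D (tabulate (image t)) ∣ ≡ oddCount (adj D ⟨ t ⟩)
∣oddVertices-image∣ {n = n} D {t} dt = begin
  ∣ oddVerticesIn D S ∣
    ≡⟨ ∣tabulate∣ (λ w → lookup S w ∧ isOdd (outDegIn D S w)) ⟩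
  count (λ w → lookup S w ∧ isOdd ∣ S ∩ outNbhd D w ∣)
    ≡⟨ sum-cong-≗ (λ w → cong₂ (λ a b → ⟦ a ∧ isOdd b ⟧) (lookup∘tabulate (image t) w) (size-in w)) ⟩
  countIn (image t) (λ w → isOdd (countIn (image t) (adj D w)))
    ≡⟨ countIn-image dt (λ w → isOdd (countIn (image t) (adj D w))) ⟩
  sum (λ j → ⟦ isOdd (countIn (image t) (adj D (t j))) ⟧)
    ≡⟨ sum-cong-≗ (λ j → cong (λ d → ⟦ isOdd d ⟧) (trans (countIn-image dt (adj D (t j))) (sum-cong-≗ (no-loop j)))) ⟩
  oddCount (adj D ⟨ t ⟩) ∎
  where
  open ≡-Reasoning
  S : Subset n
  S = tabulate (image t)
  size-in : ∀ w → ∣ S ∩ outNbhd D w ∣ ≡ countIn (image t) (adj D w)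
  size-in w = trans (cong ∣_∣ (tabulate-∩ (image t) (adj D w))) (∣tabulate∣ (λ i → image t i ∧ adj D w i))
  no-loop : ∀ j l → ⟦ adj D (t j) (t l) ⟧ ≡ ⟦ not (l == j) ∧ adj D (t j) (t l) ⟧
  no-loop j l with l ≟ j
  ... | yes refl = cong ⟦_⟧ (loopless D (t l))
  ... | no _ = refl

-- Case A: every triangle in U has an odd number of asymmetric pairs.  Fixing r ∈ U, the pair
-- {x, y} is then asymmetric exactly when x and y lie on the same side of the partition
-- side = {r} ∪ {i : {r, i} asymmetric}.  With p and q the sizes of the two sides, the number
-- of ordered asymmetric pairs is p(p-1) + q(q-1), and double counting arcs mod 4 contradicts
-- |U| ≡ 1 (mod 4) and all out-degrees being odd.
module OddTriangles (D : Digraph n) (U : VSet n) (U≡1 : [ count U ] ≡ 1F) (allOdd : AllOdd D U)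
  (oddTriangle : ∀ x y z → U x ≡ true → U y ≡ true → U z ≡ true → x ≢ y → y ≢ z → z ≢ x →
                 parity3 (adj D) x y z ≡ true) where

  A : Adj n
  A = adj D

  root : ∃ λ r → U r ≡ true
  root = count-nonzero U (λ empty → 0F≢1F (trans (sym (cong [_] empty)) U≡1))
    where
    0F≢1F : 0F ≢ 1F
    0F≢1F ()

  r : Fin n
  r = proj₁ root

  side : VSet n
  side i = (i == r) ∨ asym A r i

  -- Two distinct vertices of U form an asymmetric pair iff they lie on the same side.
  -- (Matching on x ≟ r and y ≟ r also evaluates side x and side y in the goal.)
  same-side : ∀ {x y} → U x ≡ true → U y ≡ true → x ≢ y → asym A x y ≡ not (side x xor side y)
  same-side {x} {y} Ux Uy x≢y with x ≟ r | y ≟ r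
  ... | yes refl | yes refl = ⊥-elim (x≢y refl)
  ... | yes refl | no y≢r = sym (not-involutive (asym A r y))
  ... | no x≢r | yes refl = trans (xor-comm (A x r) (A r x)) (sym (not-xor-true (asym A r x)))
    where
    not-xor-true : ∀ b → not (b xor true) ≡ b
    not-xor-true true = refl
    not-xor-true false = refl
  ... | no x≢r | no y≢r =
        solve-middle (asym A r x) (asym A x y) (A y r xor A r y)
          (oddTriangle r x y (proj₂ root) Ux Uy (λ e → x≢r (sym e)) x≢y (λ e → y≢r e))
          (xor-comm (A y r) (A r y))
    where
    solve-middle : ∀ a b c {c′} → a xor b xor c ≡ true → c ≡ c′ → b ≡ not (a xor c′)
    solve-middle true true true refl refl = refl
    solve-middle true false false refl refl = refl
    solve-middle false true false refl refl = refl
    solve-middle false false true refl refl = refl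

  p q : ℕ
  p = countIn U side
  q = countIn U (λ i → not (side i))

  size : count U ≡ p + q
  size = trans (sum-cong-≗ (λ i → by-side (U i) (side i)))
               (∑-distrib-+ (λ i → ⟦ U i ∧ side i ⟧) (λ i → ⟦ U i ∧ not (side i) ⟧))
    where
    by-side : ∀ u s → ⟦ u ⟧ ≡ ⟦ u ∧ s ⟧ + ⟦ u ∧ not s ⟧
    by-side true true = refl
    by-side true false = refl
    by-side false s = refl

  -- From x ∈ U, the asymmetric pairs together with x itself are the vertices on x's side.
  row : ∀ x → U x ≡ true → countIn U (asym A x) + 1 ≡ ⟦ side x ⟧ * p + ⟦ not (side x) ⟧ * q
  row x Ux = begin
    countIn U (asym A x) + 1
      ≡⟨ cong (_+ 1) (countIn-∖ ⁅x⁆⊆U (asym A x)) ⟩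
    (countIn ⁅ x ⁆ (asym A x) + countIn (U ∖ ⁅ x ⁆) (asym A x)) + 1
      ≡⟨ cong (λ c → (c + countIn (U ∖ ⁅ x ⁆) (asym A x)) + 1) (trans (countIn-⁅⁆ x (asym A x)) (cong ⟦_⟧ (xor-same (A x x)))) ⟩
    countIn (U ∖ ⁅ x ⁆) (asym A x) + 1
      ≡⟨ +-comm _ 1 ⟩
    1 + countIn (U ∖ ⁅ x ⁆) (asym A x)
      ≡⟨ cong₂ _+_ (sym (trans (countIn-⁅⁆ x (same x)) (cong (λ b → ⟦ not b ⟧) (xor-same (side x))))) (countIn-cong other) ⟩
    countIn ⁅ x ⁆ (same x) + countIn (U ∖ ⁅ x ⁆) (same x)
      ≡⟨ sym (countIn-∖ ⁅x⁆⊆U (same x)) ⟩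
    countIn U (same x)
      ≡⟨ sides (side x) refl ⟩
    ⟦ side x ⟧ * p + ⟦ not (side x) ⟧ * q ∎
    where
    open ≡-Reasoning
    same : Fin n → Fin n → Bool
    same x y = not (side x xor side y)
    ⁅x⁆⊆U : ⁅ x ⁆ ⊆ U
    ⁅x⁆⊆U i i==x with i ≟ x
    ... | yes refl = Ux
    other : ∀ y → (U ∖ ⁅ x ⁆) y ≡ true → asym A x y ≡ same x y
    other y h with U y in Uy | y ≟ x
    ... | true | no y≢x = same-side Ux Uy (λ e → y≢x (sym e))
    sides : ∀ s → side x ≡ s → countIn U (same x) ≡ ⟦ s ⟧ * p + ⟦ not s ⟧ * q
    sides true sx = trans (countIn-cong (λ y _ → trans (cong (λ b → not (b xor side y)) sx) (not-involutive (side y))))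
                          (sym (trans (+-identityʳ (p + 0)) (+-identityʳ p)))
    sides false sx = trans (countIn-cong (λ y _ → cong (λ b → not (b xor side y)) sx)) (sym (+-identityʳ q))

  asymmetric-pairs : pairs U (asym A) + (p + q) ≡ p * p + q * q
  asymmetric-pairs = begin
    pairs U (asym A) + (p + q)
      ≡⟨ cong (pairs U (asym A) +_) (sym size) ⟩
    pairs U (asym A) + count U
      ≡⟨ sym (∑-distrib-+ (λ x → sum (λ y → ⟦ U x ∧ (U y ∧ asym A x y) ⟧)) (λ x → ⟦ U x ⟧)) ⟩
    sum (λ x → sum (λ y → ⟦ U x ∧ (U y ∧ asym A x y) ⟧) + ⟦ U x ⟧)
      ≡⟨ sum-cong-≗ by-row ⟩
    sum (λ x → ⟦ U x ∧ side x ⟧ * p + ⟦ U x ∧ not (side x) ⟧ * q)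
      ≡⟨ ∑-distrib-+ (λ x → ⟦ U x ∧ side x ⟧ * p) (λ x → ⟦ U x ∧ not (side x) ⟧ * q) ⟩
    sum (λ x → ⟦ U x ∧ side x ⟧ * p) + sum (λ x → ⟦ U x ∧ not (side x) ⟧ * q)
      ≡⟨ sym (cong₂ _+_ (*-distribʳ-sum p (λ x → ⟦ U x ∧ side x ⟧)) (*-distribʳ-sum q (λ x → ⟦ U x ∧ not (side x) ⟧))) ⟩
    p * p + q * q ∎
    where
    open ≡-Reasoning
    by-row : ∀ x → sum (λ y → ⟦ U x ∧ (U y ∧ asym A x y) ⟧) + ⟦ U x ⟧
                   ≡ ⟦ U x ∧ side x ⟧ * p + ⟦ U x ∧ not (side x) ⟧ * q
    by-row x with U x in Ux
    ... | true = row x Ux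
    ... | false = cong (_+ 0) (sum-replicate-zero n)

  -- The number of arcs of D[U] is odd: it is a sum of |U| odd out-degrees, and |U| is odd.
  arcs-odd : odd (pairs U A) ≡ true
  arcs-odd = begin
    odd (pairs U A)                            ≡⟨ cong odd (sum-cong-≗ by-row) ⟩
    odd (sum (λ x → ⟦ U x ⟧ * deg D U x))      ≡⟨ odd-sum U (deg D U) allOdd ⟩
    odd (count U)                              ≡⟨ cong odd₄ U≡1 ⟩
    true ∎
    where
    open ≡-Reasoning
    by-row : ∀ x → sum (λ y → ⟦ U x ∧ (U y ∧ A x y) ⟧) ≡ ⟦ U x ⟧ * deg D U x
    by-row x with U x
    ... | true = sym (+-identityʳ _)
    ... | false = sum-replicate-zero n

  -- Mutual pairs are counted twice, once in each order.
  mutual-even : ∃ λ h → pairs U (λ x y → A x y ∧ A y x) ≡ h + h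
  mutual-even = handshake (λ x y → ⟦ U x ∧ (U y ∧ (A x y ∧ A y x)) ⟧) symmetric diagonal
    where
    symmetric : ∀ x y → ⟦ U x ∧ (U y ∧ (A x y ∧ A y x)) ⟧ ≡ ⟦ U y ∧ (U x ∧ (A y x ∧ A x y)) ⟧
    symmetric x y with U x | U y
    ... | true | true = cong ⟦_⟧ (∧-comm (A x y) (A y x))
    ... | true | false = refl
    ... | false | true = refl
    ... | false | false = refl
    diagonal : ∀ x → ⟦ U x ∧ (U x ∧ (A x x ∧ A x x)) ⟧ ≡ 0
    diagonal x rewrite loopless D x with U x
    ... | true = refl
    ... | false = refl

  contradiction : ⊥
  contradiction with mutual-even
  ... | h , mutual≡h+h = true≢false (trans (sym arcs-odd)
        (mod4-obstruction (pairs U A) (pairs U (asym A)) h p q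
          (trans (pairs-double U A) (cong (λ m → pairs U (asym A) + 2 * m) mutual≡h+h))
          asymmetric-pairs
          (trans (cong [_] (sym size)) U≡1)))

-- Case B: U contains a triangle x, y, z whose number of asymmetric pairs is even.  Then each
-- corner sends the same arc to both other corners.  Each corner c determines a block: c together
-- with the vertices of U it separates.  The three blocks are disjoint; each block minus its
-- corner has odd size and induces all odd out-degrees, hence (by induction) has size ≡ 3, so each
-- block has size ≡ 0 (mod 4); and the vertices of U outside all blocks again induce all odd
-- out-degrees, on a set of size ≡ 1 (mod 4), contradicting the induction hypothesis.
module EvenTriangle (D : Digraph n) (noBad3 : NoBad3 D) (noBad5 : NoBad5 D)
  (U : VSet n) (U≡1 : [ count U ] ≡ 1F) (allOdd : AllOdd D U)
  (smaller : ∀ V → count V < count U → [ count V ] ≡ 1F → AllOdd D V → ⊥) where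

  A : Adj n
  A = adj D

  oddU : odd (count U) ≡ true
  oddU = cong odd₄ U≡1

  record Triangle : Set where
    field
      x y z : Fin n
      x∈U : U x ≡ true
      y∈U : U y ≡ true
      z∈U : U z ≡ true
      x≢y : x ≢ y
      y≢z : y ≢ z
      z≢x : z ≢ x
      uniform : Uniform (A ⟨ x ∷ y ∷ z ∷ [] ⟩)

  rotate : Triangle → Triangle
  rotate T = record
    { x = y ; y = z ; z = x ; x∈U = y∈U ; y∈U = z∈U ; z∈U = x∈U
    ; x≢y = y≢z ; y≢z = z≢x ; z≢x = x≢y ; uniform = proj₁ (proj₂ uniform) , proj₂ (proj₂ uniform) , proj₁ uniform }
    where open Triangle T

  block : Triangle → VSet n
  block T i = U i ∧ ((i == x) ∨ separates A x y i)
    where open Triangle T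

  rest : Triangle → VSet n
  rest T = block T ∖ ⁅ Triangle.x T ⁆

  module Corner (T : Triangle) where
    open Triangle T

    sep : Fin n → Bool
    sep = separates A x y

    block⊆U : block T ⊆ U
    block⊆U i h = proj₁ (∧-true h)

    rest⊆U : rest T ⊆ U
    rest⊆U i h = block⊆U i (proj₁ (∖-member {V = block T} {W = ⁅ x ⁆} h))

    ⁅x⁆⊆block : ⁅ x ⁆ ⊆ block T
    ⁅x⁆⊆block i i==x with i ≟ x
    ... | yes refl = cong (_∧ true) x∈U

    rest-member : ∀ {i} → rest T i ≡ true → (i ≢ x) × (sep i ≡ true)
    rest-member {i} h with i ≟ x
    ... | yes refl = ⊥-elim (false≢true (trans (sym (∧-zeroʳ (U x ∧ true))) h))
    ... | no i≢x = i≢x , proj₂ (∧-true (trans (sym (∧-identityʳ (U i ∧ sep i))) h))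

    non-member : ∀ {i} → U i ≡ true → rest T i ≡ false → i ≢ x → sep i ≡ false
    non-member {i} Ui h i≢x with i ≟ x
    ... | yes i≡x = ⊥-elim (i≢x i≡x)
    ... | no _ = trans (sym (∧-identityʳ (sep i))) (subst (λ u → (u ∧ sep i) ∧ true ≡ false) Ui h)

    block-non-member : ∀ {i} → U i ≡ true → block T i ≡ false → (i ≢ x) × (sep i ≡ false)
    block-non-member {i} Ui h with i ≟ x
    ... | yes refl = ⊥-elim (true≢false (trans (sym (cong (_∧ true) Ui)) h))
    ... | no i≢x = i≢x , subst (λ u → u ∧ sep i ≡ false) Ui h

    Outside : Fin n → Set
    Outside i = (i ≢ x) × (i ≢ y) × (i ≢ z)

    separated-outside : ∀ {i} → i ≢ x → sep i ≡ true → Outside i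
    separated-outside {i} i≢x s = i≢x , (λ { refl → false≢true (trans (sym (xor-same (A x y))) s) })
                                       , (λ { refl → false≢true (trans (sym z-unseparated) s) })
      where
      z-unseparated : sep z ≡ false
      z-unseparated = trans (cong (_xor A x y) (proj₁ uniform)) (xor-same (A x y))

    rest-outside : ∀ {i} → rest T i ≡ true → Outside i
    rest-outside h = separated-outside (proj₁ (rest-member h)) (proj₂ (rest-member h))

    distinct₁ : ∀ {i} → Outside i → Distinct (x ∷ y ∷ z ∷ i ∷ [])
    distinct₁ {i} (i≢x , i≢y , i≢z) =
      distinct-∷ {v = y ∷ z ∷ i ∷ []} (λ { 0F → λ e → x≢y (sym e) ; 1F → z≢x ; 2F → i≢x })
     (distinct-∷ {v = z ∷ i ∷ []} (λ { 0F → λ e → y≢z (sym e) ; 1F → i≢y })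
     (distinct-∷ {v = i ∷ []} (λ { 0F → i≢z })
     (distinct-∷ {v = []} (λ ()) (λ ()))))

    distinct₂ : ∀ {u i} → Outside u → Outside i → u ≢ i → Distinct (x ∷ y ∷ z ∷ u ∷ i ∷ [])
    distinct₂ {u} {i} (u≢x , u≢y , u≢z) (i≢x , i≢y , i≢z) u≢i =
      distinct-∷ {v = y ∷ z ∷ u ∷ i ∷ []} (λ { 0F → λ e → x≢y (sym e) ; 1F → z≢x ; 2F → u≢x ; 3F → i≢x })
     (distinct-∷ {v = z ∷ u ∷ i ∷ []} (λ { 0F → λ e → y≢z (sym e) ; 1F → u≢y ; 2F → i≢y })
     (distinct-∷ {v = u ∷ i ∷ []} (λ { 0F → u≢z ; 1F → i≢z })
     (distinct-∷ {v = i ∷ []} (λ { 0F → λ e → u≢i (sym e) })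
     (distinct-∷ {v = []} (λ ()) (λ ())))))

    block-size : count (block T) ≡ 1 + count (rest T)
    block-size = trans (count-∖ ⁅x⁆⊆block)
                       (cong (_+ count (rest T)) (trans (count-as-countIn ⁅ x ⁆) (countIn-⁅⁆ x (λ _ → true))))

    -- (i) The rest of the block has odd size: count the out-degree of x.
    rest-odd : odd (count (rest T)) ≡ true
    rest-odd = corner-parity (A x y) (count (rest T)) (count (U ∖ block T)) size-parity degree-parity
      where
      size : count U ≡ (1 + count (rest T)) + count (U ∖ block T)
      size = trans (count-∖ block⊆U) (cong (_+ count (U ∖ block T)) block-size)
      size-parity : odd ((1 + count (rest T)) + count (U ∖ block T)) ≡ true
      size-parity = trans (cong odd (sym size)) oddU
      degree : deg D U x ≡ (0 + ⟦ not (A x y) ⟧ * count (rest T)) + ⟦ A x y ⟧ * count (U ∖ block T)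
      degree = begin
        countIn U (A x)
          ≡⟨ countIn-∖ block⊆U (A x) ⟩
        countIn (block T) (A x) + countIn (U ∖ block T) (A x)
          ≡⟨ cong (_+ countIn (U ∖ block T) (A x)) (countIn-∖ ⁅x⁆⊆block (A x)) ⟩
        (countIn ⁅ x ⁆ (A x) + countIn (rest T) (A x)) + countIn (U ∖ block T) (A x)
          ≡⟨ cong₂ (λ a b → (a + b) + countIn (U ∖ block T) (A x))
                   (trans (countIn-⁅⁆ x (A x)) (cong ⟦_⟧ (loopless D x)))
                   (countIn-const {V = rest T} {g = A x} (not (A x y)) (λ i h → xor-true (proj₂ (rest-member {i} h)))) ⟩
        (0 + ⟦ not (A x y) ⟧ * count (rest T)) + countIn (U ∖ block T) (A x)
          ≡⟨ cong ((0 + ⟦ not (A x y) ⟧ * count (rest T)) +_)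
                  (countIn-const {V = U ∖ block T} {g = A x} (A x y) (λ i h → xor-false (proj₂ (outside-block {i} h)))) ⟩
        (0 + ⟦ not (A x y) ⟧ * count (rest T)) + ⟦ A x y ⟧ * count (U ∖ block T) ∎
        where
        open ≡-Reasoning
        outside-block : ∀ {i} → (U ∖ block T) i ≡ true → (i ≢ x) × (sep i ≡ false)
        outside-block h = block-non-member (proj₁ (∖-member {V = U} {W = block T} h)) (proj₂ (∖-member {V = U} {W = block T} h))
      degree-parity : odd ((0 + ⟦ not (A x y) ⟧ * count (rest T)) + ⟦ A x y ⟧ * count (U ∖ block T)) ≡ true
      degree-parity = trans (cong odd (sym degree)) (allOdd x x∈U)

    rest-toward-outside : ∀ {u} → rest T u ≡ true → ∀ i → (U ∖ rest T) i ≡ true → A u i ≡ A u x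
    rest-toward-outside {u} u∈rest i h = toward i u≢i (non-member Ui i∉rest)
      where
      Ui : U i ≡ true
      Ui = proj₁ (∖-member {V = U} {W = rest T} h)
      i∉rest : rest T i ≡ false
      i∉rest = proj₂ (∖-member {V = U} {W = rest T} h)
      u≢i : u ≢ i
      u≢i refl = false≢true (trans (sym i∉rest) u∈rest)
      toward-corners : (separates A y z u ≡ false) × (A u y ≡ A u x) × (A u z ≡ A u x)
      toward-corners = separated-vertex (A ⟨ x ∷ y ∷ z ∷ u ∷ [] ⟩)
        (good4-induced {D = D} noBad3 (distinct₁ (rest-outside u∈rest))) uniform (proj₂ (rest-member u∈rest))
      toward : ∀ i → u ≢ i → (i ≢ x → sep i ≡ false) → A u i ≡ A u x
      toward i u≢i unsep with i ≟ x | i ≟ y | i ≟ z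
      ... | yes refl | _ | _ = refl
      ... | no _ | yes refl | _ = proj₁ (proj₂ toward-corners)
      ... | no _ | no _ | yes refl = proj₂ (proj₂ toward-corners)
      ... | no i≢x | no i≢y | no i≢z =
        separated-to-unseparated (A ⟨ x ∷ y ∷ z ∷ u ∷ i ∷ [] ⟩)
          (good5-induced {D = D} noBad3 noBad5 (distinct₂ (rest-outside u∈rest) (i≢x , i≢y , i≢z) u≢i))
          uniform (proj₂ (rest-member u∈rest)) (unsep i≢x)

    rest-all-odd : AllOdd D (rest T)
    rest-all-odd u u∈rest = begin
      odd (countIn (rest T) (A u))
        ≡⟨ sym (even-+ʳ (countIn (rest T) (A u)) (⟦ A u x ⟧ * count (U ∖ rest T)) (*-even ⟦ A u x ⟧ _ complement-even)) ⟩
      odd (countIn (rest T) (A u) + ⟦ A u x ⟧ * count (U ∖ rest T))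
        ≡⟨ cong (λ c → odd (countIn (rest T) (A u) + c))
                (sym (countIn-const {V = U ∖ rest T} {g = A u} (A u x) (rest-toward-outside u∈rest))) ⟩
      odd (countIn (rest T) (A u) + countIn (U ∖ rest T) (A u))
        ≡⟨ cong odd (sym (countIn-∖ rest⊆U (A u))) ⟩
      odd (deg D U u)
        ≡⟨ allOdd u (rest⊆U u u∈rest) ⟩
      true ∎
      where
      open ≡-Reasoning
      complement-even : odd (count (U ∖ rest T)) ≡ false
      complement-even = odd-difference (count (rest T)) (count (U ∖ rest T))
                          (trans (cong odd (sym (count-∖ rest⊆U))) oddU) rest-odd

    -- (iv) By induction the rest has size ≡ 3, so the block has size ≡ 0 (mod 4).
    block-residue : [ count (block T) ] ≡ 0F
    block-residue = trans (cong [_] block-size)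
                          (odd-not-1 [ count (rest T) ] rest-odd (λ r≡1 → smaller (rest T) rest<U r≡1 rest-all-odd))
      where
      x∉rest : rest T x ≡ false
      x∉rest = trans (cong (λ b → (U x ∧ (b ∨ sep x)) ∧ not b) (==-self x)) (∧-zeroʳ (U x ∧ true))
      rest<U : count (rest T) < count U
      rest<U = count-∖-< rest⊆U x∈U x∉rest

    block-even : odd (count (block T)) ≡ false
    block-even = cong odd₄ block-residue

    disjoint-next : ∀ {i} → block T i ≡ true → block (rotate T) i ≡ false
    disjoint-next {i} i∈block with i ≟ x
    ... | yes refl = trans (cong₂ (λ a b → U x ∧ (a ∨ b)) (==-other x≢y)
                                  (trans (cong (_xor A y z) (proj₁ (proj₂ uniform))) (xor-same (A y z))))
                           (∧-zeroʳ (U x))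
    ... | no i≢x = trans (cong₂ (λ a b → U i ∧ (a ∨ b)) (==-other (proj₁ (proj₂ outside))) (proj₁ toward-corners)) (∧-zeroʳ (U i))
      where
      separated : sep i ≡ true
      separated = proj₂ (∧-true i∈block)
      outside : Outside i
      outside = separated-outside i≢x separated
      toward-corners : (separates A y z i ≡ false) × (A i y ≡ A i x) × (A i z ≡ A i x)
      toward-corners = separated-vertex (A ⟨ x ∷ y ∷ z ∷ i ∷ [] ⟩) (good4-induced {D = D} noBad3 (distinct₁ outside)) uniform separated

  unseparated-toward-block : (T : Triangle) → ∀ {w} → U w ≡ true →
    block T w ≡ false → block (rotate T) w ≡ false → block (rotate (rotate T)) w ≡ false →
    ∀ i → block T i ≡ true → A w i ≡ A w (Triangle.x T)
  unseparated-toward-block T {w} Uw w∉B₁ w∉B₂ w∉B₃ i i∈B = toward i w≢i i∈B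
    where
    open Triangle T
    open Corner T using (Outside; distinct₂; separated-outside)
    nm₁ : (w ≢ x) × (separates A x y w ≡ false)
    nm₁ = Corner.block-non-member T Uw w∉B₁
    nm₂ : (w ≢ y) × (separates A y z w ≡ false)
    nm₂ = Corner.block-non-member (rotate T) Uw w∉B₂
    nm₃ : (w ≢ z) × (separates A z x w ≡ false)
    nm₃ = Corner.block-non-member (rotate (rotate T)) Uw w∉B₃
    w-outside : Outside w
    w-outside = proj₁ nm₁ , proj₁ nm₂ , proj₁ nm₃
    w≢i : w ≢ i
    w≢i refl = false≢true (trans (sym w∉B₁) i∈B)
    toward : ∀ i → w ≢ i → block T i ≡ true → A w i ≡ A w x
    toward i w≢i i∈B with i ≟ x
    ... | yes refl = refl
    ... | no i≢x = unseparated-to-separated (A ⟨ x ∷ y ∷ z ∷ w ∷ i ∷ [] ⟩)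
        (good5-induced {D = D} noBad3 noBad5 (distinct₂ w-outside (separated-outside i≢x separated) w≢i))
        uniform (proj₂ nm₁) (proj₂ nm₂) (proj₂ nm₃) separated
      where
      separated : separates A x y i ≡ true
      separated = proj₂ (∧-true i∈B)

  -- (vii) Removing the three blocks from U leaves a set W with [ |W| ] ≡ 1 in which all
  -- out-degrees are odd; W is smaller than U, contradicting the induction hypothesis.
  module Remainder (T : Triangle) where
    open Corner using (block⊆U; disjoint-next; block-residue; block-even)

    T₂ T₃ : Triangle
    T₂ = rotate T
    T₃ = rotate T₂

    U₁ U₂ W : VSet n
    U₁ = U ∖ block T
    U₂ = U₁ ∖ block T₂
    W = U₂ ∖ block T₃

    block₂⊆U₁ : block T₂ ⊆ U₁
    block₂⊆U₁ i h = ∖-intro {V = U} {W = block T} {i = i} (block⊆U T₂ i h) (contrapositive (disjoint-next T) h)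

    block₃⊆U₂ : block T₃ ⊆ U₂
    block₃⊆U₂ i h = ∖-intro {V = U₁} {W = block T₂} {i = i}
                      (∖-intro {V = U} {W = block T} {i = i} (block⊆U T₃ i h) (disjoint-next T₃ h))
                      (contrapositive (disjoint-next T₂) h)

    W⊆U₁ : W ⊆ U₁
    W⊆U₁ i h = proj₁ (∖-member {V = U₁} {W = block T₂} (proj₁ (∖-member {V = U₂} {W = block T₃} h)))

    W⊆U : W ⊆ U
    W⊆U i h = proj₁ (∖-member {V = U} {W = block T} (W⊆U₁ i h))

    sizes : count U ≡ count (block T) + (count (block T₂) + (count (block T₃) + count W))
    sizes = trans (count-∖ (block⊆U T))
                  (cong (count (block T) +_) (trans (count-∖ block₂⊆U₁) (cong (count (block T₂) +_) (count-∖ block₃⊆U₂))))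

    W-residue : [ count W ] ≡ 1F
    W-residue = begin
      [ count W ]
        ≡⟨ sym (cong₂ _+₄_ (block-residue T) (cong₂ _+₄_ (block-residue T₂) (cong (_+₄ [ count W ]) (block-residue T₃)))) ⟩
      [ count (block T) ] +₄ ([ count (block T₂) ] +₄ ([ count (block T₃) ] +₄ [ count W ]))
        ≡⟨ sym (trans ([+] (count (block T)) _) (cong ([ count (block T) ] +₄_)
                (trans ([+] (count (block T₂)) _) (cong ([ count (block T₂) ] +₄_) ([+] (count (block T₃)) (count W)))))) ⟩
      [ count (block T) + (count (block T₂) + (count (block T₃) + count W)) ]
        ≡⟨ cong [_] (sym sizes) ⟩
      [ count U ]
        ≡⟨ U≡1 ⟩
      1F ∎
      where open ≡-Reasoning

    W-all-odd : AllOdd D W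
    W-all-odd w w∈W = begin
      odd (countIn W (A w))
        ≡⟨ sym (parity-peel (A w z) block₃⊆U₂ (unseparated-toward-block T₃ w∈U w∉B₃ w∉B₁ w∉B₂) (block-even T₃)) ⟩
      odd (countIn U₂ (A w))
        ≡⟨ sym (parity-peel (A w y) block₂⊆U₁ (unseparated-toward-block T₂ w∈U w∉B₂ w∉B₃ w∉B₁) (block-even T₂)) ⟩
      odd (countIn U₁ (A w))
        ≡⟨ sym (parity-peel (A w x) (block⊆U T) (unseparated-toward-block T w∈U w∉B₁ w∉B₂ w∉B₃) (block-even T)) ⟩
      odd (countIn U (A w))
        ≡⟨ allOdd w w∈U ⟩
      true ∎
      where
      open ≡-Reasoning
      open Triangle T
      w∈U₂ : U₂ w ≡ true
      w∈U₂ = proj₁ (∖-member {V = U₂} {W = block T₃} w∈W)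
      w∉B₃ : block T₃ w ≡ false
      w∉B₃ = proj₂ (∖-member {V = U₂} {W = block T₃} w∈W)
      w∈U₁ : U₁ w ≡ true
      w∈U₁ = proj₁ (∖-member {V = U₁} {W = block T₂} w∈U₂)
      w∉B₂ : block T₂ w ≡ false
      w∉B₂ = proj₂ (∖-member {V = U₁} {W = block T₂} w∈U₂)
      w∈U : U w ≡ true
      w∈U = proj₁ (∖-member {V = U} {W = block T} w∈U₁)
      w∉B₁ : block T w ≡ false
      w∉B₁ = proj₂ (∖-member {V = U} {W = block T} w∈U₁)

    W<U : count W < count U
    W<U = count-∖-< W⊆U x∈U (⊆-false W⊆U₁ (∖-excludes {V = U} {W = block T} (Corner.⁅x⁆⊆block T x (==-self x))))
      where open Triangle T

  contradiction : Triangle → ⊥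
  contradiction T = smaller W W<U W-residue W-all-odd
    where open Remainder T

EvenTriangleIn : Digraph n → VSet n → Fin n → Fin n → Fin n → Set
EvenTriangleIn D U x y z =
  (U x ≡ true) × (U y ≡ true) × (U z ≡ true) × (x ≢ y) × (y ≢ z) × (z ≢ x) × (parity3 (adj D) x y z ≡ false)

even-triangle? : (D : Digraph n) (U : VSet n) → Dec (∃ λ x → ∃ λ y → ∃ λ z → EvenTriangleIn D U x y z)
even-triangle? D U = any? λ x → any? λ y → any? λ z →
  (U x ≟ᵇ true) ×-dec (U y ≟ᵇ true) ×-dec (U z ≟ᵇ true) ×-dec ¬? (x ≟ y) ×-dec ¬? (y ≟ z) ×-dec ¬? (z ≟ x)
  ×-dec (parity3 (adj D) x y z ≟ᵇ false)

no-odd-set : (D : Digraph n) → NoBad3 D → NoBad5 D → (U : VSet n) → [ count U ] ≡ 1F → AllOdd D U → ⊥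
no-odd-set {n} D noBad3 noBad5 U = <-rec Claim step (count U) U refl
  where
  Claim : ℕ → Set
  Claim m = (U : VSet n) → count U ≡ m → [ count U ] ≡ 1F → AllOdd D U → ⊥
  step : ∀ m → (∀ {m′} → m′ < m → Claim m′) → Claim m
  step m induction U refl U≡1 allOdd with even-triangle? D U
  ... | yes (x , y , z , x∈U , y∈U , z∈U , x≢y , y≢z , z≢x , even) =
    EvenTriangle.contradiction D noBad3 noBad5 U U≡1 allOdd (λ V V<U → induction V<U V refl) triangle
    where
    distinct : Distinct (x ∷ y ∷ z ∷ [])
    distinct = distinct-∷ {v = y ∷ z ∷ []} (λ { 0F → λ e → x≢y (sym e) ; 1F → z≢x })
              (distinct-∷ {v = z ∷ []} (λ { 0F → λ e → y≢z (sym e) }) (distinct-∷ {v = []} (λ ()) (λ ())))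
    triangle : EvenTriangle.Triangle D noBad3 noBad5 U U≡1 allOdd (λ V V<U → induction V<U V refl)
    triangle = record
      { x = x ; y = y ; z = z ; x∈U = x∈U ; y∈U = y∈U ; z∈U = z∈U ; x≢y = x≢y ; y≢z = y≢z ; z≢x = z≢x
      ; uniform = even-triangle-uniform (adj D ⟨ x ∷ y ∷ z ∷ [] ⟩) (good3-induced {D = D} noBad3 distinct) even }
  ... | no none = OddTriangles.contradiction D U U≡1 allOdd odd-triangle
    where
    odd-triangle : ∀ x y z → U x ≡ true → U y ≡ true → U z ≡ true → x ≢ y → y ≢ z → z ≢ x →
                   parity3 (adj D) x y z ≡ true
    odd-triangle x y z x∈U y∈U z∈U x≢y y≢z z≢x with parity3 (adj D) x y z in p
    ... | true = refl
    ... | false = ⊥-elim (none (x , y , z , x∈U , y∈U , z∈U , x≢y , y≢z , z≢x , p))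

lemma10 : (n : ℕ) → n % 4 ≡ 1 → (D : Digraph n)
    → (∀ v → outDeg D v % 2 ≡ 1)
    → (Σ (Subset n) λ S → ∣ S ∣ ≡ 3 × ∣ oddVerticesIn D S ∣ ≡ 2)
      ⊎ (Σ (Subset n) λ S → ∣ S ∣ ≡ 5 × ∣ oddVerticesIn D S ∣ ≡ 3)
lemma10 n n≡1 D odd-degrees with anySubset? (λ S → (∣ S ∣ ≟ℕ 3) ×-dec (∣ oddVerticesIn D S ∣ ≟ℕ 2))
... | yes bad3 = inj₁ bad3
... | no no-bad3 with anySubset? (λ S → (∣ S ∣ ≟ℕ 5) ×-dec (∣ oddVerticesIn D S ∣ ≟ℕ 3))
...   | yes bad5 = inj₂ bad5
...   | no no-bad5 = ⊥-elim (no-odd-set D noBad3 noBad5 (λ _ → true) whole≡1 all-odd)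
  where
  noBad3 : NoBad3 D
  noBad3 t distinct two =
    no-bad3 (tabulate (image t) , ∣image∣ distinct , trans (∣oddVertices-image∣ D distinct) two)
  noBad5 : NoBad5 D
  noBad5 t distinct three =
    no-bad5 (tabulate (image t) , ∣image∣ distinct , trans (∣oddVertices-image∣ D distinct) three)
  whole≡1 : [ count {n} (λ _ → true) ] ≡ 1F
  whole≡1 = trans (cong [_] (count-all {n})) (trans ([m]≡[m%4] n) (cong [_] n≡1))
  all-odd : AllOdd D (λ _ → true)
  all-odd v _ =
    trans (cong odd (sym (∣tabulate∣ (adj D v)))) (trans (odd≡odd[m%2] (outDeg D v)) (cong odd (odd-degrees v)))
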